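{- Let $(\mathbb{X},\dagger)$ be a dagger category with finite $\dagger$-biproducts. If $(u_1: A\to X_1\oplus Z_1, d_1: X_1\to Y_1, v_1: Y_1\oplus W_1\to B)$ and $(u_2: A\to X_2\oplus Z_2, d_2: X_2\to Y_2, v_2: Y_2\oplus W_2\to B)$ are both generalized singular value decompositions of $f: A\to B$, then there exist unique unitary maps $x: X_1\to X_2$, $y: Y_1\to Y_2$, $z: Z_1\to Z_2$ and $w: W_1\to W_2$ such that $u_1(x\oplus z) = u_2$, $d_1 y = x d_2$, and $v_1 = (y\oplus w)v_2$.
   Context: Composition is in diagrammatic order. A dagger category is a category with an identity-on-objects contravariant involutive functor $\dagger$. Unitary: $u$ with $uu^\dagger = 1$ and $u^\dagger u = 1$. Finite $\dagger$-biproducts: finite biproducts $\oplus$ (with zero maps $0$) whose projections $\pi_j$ and injections $\iota_j$ satisfy $\pi_j^\dagger = \iota_j$. A generalized singular value decomposition of $f: A\to B$ is a triple $(u: A\to X\oplus Z, d: X\to Y, v: Y\oplus W\to B)$ with $u, v$ unitary, $d$ an isomorphism and $f = u(d\oplus 0)v$, where $0: Z\to W$ is the zero map. -}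

module Defs where

open import Level using (Level; _⊔_; suc)
open import Relation.Binary using (IsEquivalence)

-- A category with hom-setoids; composition is written in DIAGRAMMATIC order:
-- f ⨾ g  means "first f, then g".
record DaggerCategory (o ℓ e : Level) : Set (suc (o ⊔ ℓ ⊔ e)) where
  infixr 9 _⨾_
  infix  4 _≈_
  infix  10 _†
  field
    Obj   : Set o
    Hom   : Obj → Obj → Set ℓ
    _≈_   : ∀ {A B} → Hom A B → Hom A B → Set e
    ≈-equiv : ∀ {A B} → IsEquivalence (_≈_ {A} {B})
    id    : ∀ {A} → Hom A A
    _⨾_   : ∀ {A B C} → Hom A B → Hom B C → Hom A C
    ⨾-cong : ∀ {A B C} {f f′ : Hom A B} {g g′ : Hom B C} →
             f ≈ f′ → g ≈ g′ → f ⨾ g ≈ f′ ⨾ g′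
    assoc  : ∀ {A B C D} (f : Hom A B) (g : Hom B C) (h : Hom C D) →
             (f ⨾ g) ⨾ h ≈ f ⨾ (g ⨾ h)
    idˡ    : ∀ {A B} (f : Hom A B) → id ⨾ f ≈ f
    idʳ    : ∀ {A B} (f : Hom A B) → f ⨾ id ≈ f
    _†     : ∀ {A B} → Hom A B → Hom B A
    †-cong : ∀ {A B} {f g : Hom A B} → f ≈ g → f † ≈ g †
    †-id   : ∀ {A} → (id {A}) † ≈ id
    †-⨾    : ∀ {A B C} (f : Hom A B) (g : Hom B C) → (f ⨾ g) † ≈ g † ⨾ f †
    †-invol : ∀ {A B} (f : Hom A B) → (f †) † ≈ f

  record Unitary {A B : Obj} (u : Hom A B) : Set e where
    field
      unitˡ : u ⨾ u † ≈ id
      unitʳ : u † ⨾ u ≈ id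

  record IsIso {A B : Obj} (f : Hom A B) : Set (ℓ ⊔ e) where
    field
      inv   : Hom B A
      isoˡ  : f ⨾ inv ≈ id
      isoʳ  : inv ⨾ f ≈ id

-- A dagger category with finite †-biproducts: a zero object together with a
-- chosen binary biproduct A ⊕ B for every pair of objects (product and
-- coproduct on the same object with ιᵢ πⱼ = δᵢⱼ), such that πⱼ† = ιⱼ.
record DaggerBiproductCategory (o ℓ e : Level) : Set (suc (o ⊔ ℓ ⊔ e)) where
  field
    dagCat : DaggerCategory o ℓ e
  open DaggerCategory dagCat public
  infixr 6 _⊕_
  field
    𝟘     : Obj
    ¡     : ∀ {A} → Hom 𝟘 A
    !     : ∀ {A} → Hom A 𝟘
    ¡-unique : ∀ {A} (f : Hom 𝟘 A) → f ≈ ¡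
    !-unique : ∀ {A} (f : Hom A 𝟘) → f ≈ !

  zero : ∀ {A B} → Hom A B
  zero = ! ⨾ ¡

  field
    _⊕_   : Obj → Obj → Obj
    π₁    : ∀ {A B} → Hom (A ⊕ B) A
    π₂    : ∀ {A B} → Hom (A ⊕ B) B
    ι₁    : ∀ {A B} → Hom A (A ⊕ B)
    ι₂    : ∀ {A B} → Hom B (A ⊕ B)
    ⟨_,_⟩ : ∀ {C A B} → Hom C A → Hom C B → Hom C (A ⊕ B)
    ⟨⟩-π₁ : ∀ {C A B} (f : Hom C A) (g : Hom C B) → ⟨ f , g ⟩ ⨾ π₁ ≈ f
    ⟨⟩-π₂ : ∀ {C A B} (f : Hom C A) (g : Hom C B) → ⟨ f , g ⟩ ⨾ π₂ ≈ g
    ⟨⟩-unique : ∀ {C A B} {f : Hom C A} {g : Hom C B} (h : Hom C (A ⊕ B)) →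
                h ⨾ π₁ ≈ f → h ⨾ π₂ ≈ g → h ≈ ⟨ f , g ⟩
    [_,_] : ∀ {A B C} → Hom A C → Hom B C → Hom (A ⊕ B) C
    ι₁-[] : ∀ {A B C} (f : Hom A C) (g : Hom B C) → ι₁ ⨾ [ f , g ] ≈ f
    ι₂-[] : ∀ {A B C} (f : Hom A C) (g : Hom B C) → ι₂ ⨾ [ f , g ] ≈ g
    []-unique : ∀ {A B C} {f : Hom A C} {g : Hom B C} (h : Hom (A ⊕ B) C) →
                ι₁ ⨾ h ≈ f → ι₂ ⨾ h ≈ g → h ≈ [ f , g ]
    ι₁π₁ : ∀ {A B} → ι₁ {A} {B} ⨾ π₁ ≈ id
    ι₂π₂ : ∀ {A B} → ι₂ {A} {B} ⨾ π₂ ≈ id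
    ι₁π₂ : ∀ {A B} → ι₁ {A} {B} ⨾ π₂ ≈ zero
    ι₂π₁ : ∀ {A B} → ι₂ {A} {B} ⨾ π₁ ≈ zero
    π₁† : ∀ {A B} → (π₁ {A} {B}) † ≈ ι₁
    π₂† : ∀ {A B} → (π₂ {A} {B}) † ≈ ι₂

  _⊕₁_ : ∀ {A B C D} → Hom A B → Hom C D → Hom (A ⊕ C) (B ⊕ D)
  f ⊕₁ g = ⟨ π₁ ⨾ f , π₂ ⨾ g ⟩

  record IsGSVD {A B X Y Z W : Obj} (f : Hom A B)
                (u : Hom A (X ⊕ Z)) (d : Hom X Y) (v : Hom (Y ⊕ W) B)
                : Set (ℓ ⊔ e) where
    field
      u-unitary : Unitary u
      v-unitary : Unitary v
      d-iso     : IsIso d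
      factor    : f ≈ u ⨾ (d ⊕₁ zero {Z} {W}) ⨾ v

-- Comparing two decompositions f = u₁ (d₁ ⊕ 0) v₁ = u₂ (d₂ ⊕ 0) v₂ gives
-- (d₁ ⊕ 0) V = U (d₂ ⊕ 0) with U = u₁† u₂ and V = v₁ v₂† unitary. Reading
-- this square entrywise, invertibility of d₂ kills the lower-left block of U
-- and invertibility of d₁ the upper-right block of V; since U and V are
-- unitary, the square may be transposed to (d₂ ⊕ 0) V† = U† (d₁ ⊕ 0), which
-- kills the two remaining off-diagonal blocks. So U = x ⊕ z and V = y ⊕ w are
-- diagonal, their blocks are unitary, and the upper-left entry of the square
-- reads d₁ y = x d₂. Uniqueness holds because x ⊕ z and y ⊕ w are forced to
-- be U and V.
module Submission where

open import Defs
open import Level using (Level)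
open import Data.Product using (Σ-syntax; _×_; _,_; proj₁; proj₂)
open import Relation.Binary using (IsEquivalence; Setoid)
import Relation.Binary.Reasoning.Setoid as SetoidReasoning

module Properties {o ℓ e : Level} (𝒞 : DaggerBiproductCategory o ℓ e) where
  open DaggerBiproductCategory 𝒞

  hom-setoid : Obj → Obj → Setoid ℓ e
  hom-setoid A B = record { isEquivalence = ≈-equiv {A} {B} }

  module ≈ {A B : Obj} = IsEquivalence (≈-equiv {A} {B})
  open module HomReasoning {A B : Obj} = SetoidReasoning (hom-setoid A B)

  private
    variable
      A B C D E F P Q R S T : Obj

  ⨾-congˡ : {f : Hom A B} {g g′ : Hom B C} → g ≈ g′ → f ⨾ g ≈ f ⨾ g′
  ⨾-congˡ p = ⨾-cong ≈.refl p

  ⨾-congʳ : {f f′ : Hom A B} {g : Hom B C} → f ≈ f′ → f ⨾ g ≈ f′ ⨾ g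
  ⨾-congʳ p = ⨾-cong p ≈.refl

  ⨾-assoc : {f : Hom A B} {g : Hom B C} {h : Hom C D} → (f ⨾ g) ⨾ h ≈ f ⨾ g ⨾ h
  ⨾-assoc = assoc _ _ _

  zero-⨾ : {g : Hom B C} → zero {A} {B} ⨾ g ≈ zero
  zero-⨾ = ≈.trans ⨾-assoc (⨾-congˡ (¡-unique _))

  ⨾-zero : {f : Hom A B} → f ⨾ zero {B} {C} ≈ zero
  ⨾-zero = ≈.trans (≈.sym ⨾-assoc) (⨾-congʳ (!-unique _))

  zero-† : zero {A} {B} † ≈ zero
  zero-† = ≈.trans (†-⨾ ! ¡) (⨾-cong (!-unique _) (¡-unique _))

  †-reflects-zero : {f : Hom A B} → f † ≈ zero → f ≈ zero
  †-reflects-zero {f = f} p = begin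
    f         ≈⟨ †-invol f ⟨
    (f †) †   ≈⟨ †-cong p ⟩
    zero †    ≈⟨ zero-† ⟩
    zero      ∎

  †-⨾³ : (f : Hom A B) (g : Hom B C) (h : Hom C D) → (f ⨾ g ⨾ h) † ≈ h † ⨾ g † ⨾ f †
  †-⨾³ f g h = begin
    (f ⨾ g ⨾ h) †        ≈⟨ †-⨾ f (g ⨾ h) ⟩
    (g ⨾ h) † ⨾ f †      ≈⟨ ⨾-congʳ (†-⨾ g h) ⟩
    (h † ⨾ g †) ⨾ f †    ≈⟨ ⨾-assoc ⟩
    h † ⨾ g † ⨾ f †      ∎

  inverse-cancelˡ : {f : Hom A B} {g : Hom B A} {h : Hom A C} → f ⨾ g ≈ id → f ⨾ g ⨾ h ≈ h
  inverse-cancelˡ {f = f} {g} {h} fg≈id = begin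
    f ⨾ g ⨾ h    ≈⟨ ⨾-assoc ⟨
    (f ⨾ g) ⨾ h  ≈⟨ ⨾-congʳ fg≈id ⟩
    id ⨾ h       ≈⟨ idˡ h ⟩
    h            ∎

  inverse-cancelʳ : {f : Hom A B} {g : Hom B A} {h : Hom C A} → f ⨾ g ≈ id → (h ⨾ f) ⨾ g ≈ h
  inverse-cancelʳ {f = f} {g} {h} fg≈id = begin
    (h ⨾ f) ⨾ g  ≈⟨ ⨾-assoc ⟩
    h ⨾ f ⨾ g    ≈⟨ ⨾-congˡ fg≈id ⟩
    h ⨾ id       ≈⟨ idʳ h ⟩
    h            ∎

  IsIso-cancelʳ : {g h : Hom A B} {d : Hom B C} → IsIso d → g ⨾ d ≈ h ⨾ d → g ≈ h
  IsIso-cancelʳ {g = g} {h} {d} iso p = begin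
    g                        ≈⟨ inverse-cancelʳ (IsIso.isoˡ iso) ⟨
    (g ⨾ d) ⨾ IsIso.inv iso  ≈⟨ ⨾-congʳ p ⟩
    (h ⨾ d) ⨾ IsIso.inv iso  ≈⟨ inverse-cancelʳ (IsIso.isoˡ iso) ⟩
    h                        ∎

  IsIso-cancelˡ : {d : Hom A B} {g h : Hom B C} → IsIso d → d ⨾ g ≈ d ⨾ h → g ≈ h
  IsIso-cancelˡ {d = d} {g} {h} iso p = begin
    g                        ≈⟨ inverse-cancelˡ (IsIso.isoʳ iso) ⟨
    IsIso.inv iso ⨾ d ⨾ g    ≈⟨ ⨾-congˡ p ⟩
    IsIso.inv iso ⨾ d ⨾ h    ≈⟨ inverse-cancelˡ (IsIso.isoʳ iso) ⟩
    h                        ∎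

  Unitary-resp : {f g : Hom A B} → f ≈ g → Unitary f → Unitary g
  Unitary-resp p u = record
    { unitˡ = ≈.trans (⨾-cong (≈.sym p) (†-cong (≈.sym p))) (Unitary.unitˡ u)
    ; unitʳ = ≈.trans (⨾-cong (†-cong (≈.sym p)) (≈.sym p)) (Unitary.unitʳ u)
    }

  Unitary-† : {f : Hom A B} → Unitary f → Unitary (f †)
  Unitary-† u = record
    { unitˡ = ≈.trans (⨾-congˡ (†-invol _)) (Unitary.unitʳ u)
    ; unitʳ = ≈.trans (⨾-congʳ (†-invol _)) (Unitary.unitˡ u)
    }

  unitary-transposeˡ : {u : Hom A B} {g : Hom B C} {h : Hom A C} →
                       Unitary u → u ⨾ g ≈ h → g ≈ u † ⨾ h
  unitary-transposeˡ uu p = ≈.trans (≈.sym (inverse-cancelˡ (Unitary.unitʳ uu))) (⨾-congˡ p)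

  unitary-transposeʳ : {v : Hom B C} {f : Hom A C} {g : Hom A B} →
                       Unitary v → f ≈ g ⨾ v → f ⨾ v † ≈ g
  unitary-transposeʳ uv p = ≈.trans (⨾-congʳ p) (inverse-cancelʳ (Unitary.unitˡ uv))

  Unitary-⨾ : {f : Hom A B} {g : Hom B C} → Unitary f → Unitary g → Unitary (f ⨾ g)
  Unitary-⨾ {f = f} {g} uf ug = record
    { unitˡ = begin
        (f ⨾ g) ⨾ (f ⨾ g) †    ≈⟨ ⨾-congˡ (†-⨾ f g) ⟩
        (f ⨾ g) ⨾ (g † ⨾ f †)  ≈⟨ ⨾-assoc ⟩
        f ⨾ g ⨾ (g † ⨾ f †)    ≈⟨ ⨾-congˡ (inverse-cancelˡ (Unitary.unitˡ ug)) ⟩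
        f ⨾ f †                ≈⟨ Unitary.unitˡ uf ⟩
        id                     ∎
    ; unitʳ = begin
        (f ⨾ g) † ⨾ (f ⨾ g)    ≈⟨ ⨾-congʳ (†-⨾ f g) ⟩
        (g † ⨾ f †) ⨾ f ⨾ g    ≈⟨ ⨾-assoc ⟩
        g † ⨾ f † ⨾ f ⨾ g      ≈⟨ ⨾-congˡ (inverse-cancelˡ (Unitary.unitʳ uf)) ⟩
        g † ⨾ g                ≈⟨ Unitary.unitʳ ug ⟩
        id                     ∎
    }

  square-transpose : {d₁ : Hom P Q} {V : Hom Q S} {U : Hom P R} {d₂ : Hom R S} →
                     Unitary U → Unitary V → d₁ ⨾ V ≈ U ⨾ d₂ → d₂ ⨾ V † ≈ U † ⨾ d₁
  square-transpose {d₁ = d₁} {V} {U} {d₂} uU uV square =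
    unitary-transposeʳ uV (begin
      d₂              ≈⟨ unitary-transposeˡ uU (≈.sym square) ⟩
      U † ⨾ d₁ ⨾ V    ≈⟨ ⨾-assoc ⟨
      (U † ⨾ d₁) ⨾ V  ∎)

  ι₁† : ι₁ {A} {B} † ≈ π₁
  ι₁† = ≈.trans (†-cong (≈.sym π₁†)) (†-invol _)

  ι₂† : ι₂ {A} {B} † ≈ π₂
  ι₂† = ≈.trans (†-cong (≈.sym π₂†)) (†-invol _)

  π-ext : {h k : Hom C (A ⊕ B)} → h ⨾ π₁ ≈ k ⨾ π₁ → h ⨾ π₂ ≈ k ⨾ π₂ → h ≈ k
  π-ext {h = h} {k} p q = ≈.trans (⟨⟩-unique h p q) (≈.sym (⟨⟩-unique k ≈.refl ≈.refl))

  ι-ext : {h k : Hom (A ⊕ B) C} → ι₁ ⨾ h ≈ ι₁ ⨾ k → ι₂ ⨾ h ≈ ι₂ ⨾ k → h ≈ k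
  ι-ext {h = h} {k} p q = ≈.trans ([]-unique h p q) (≈.sym ([]-unique k ≈.refl ≈.refl))

  ⊕₁-π₁ : {f : Hom A B} {g : Hom C D} → (f ⊕₁ g) ⨾ π₁ ≈ π₁ ⨾ f
  ⊕₁-π₁ = ⟨⟩-π₁ _ _

  ⊕₁-π₂ : {f : Hom A B} {g : Hom C D} → (f ⊕₁ g) ⨾ π₂ ≈ π₂ ⨾ g
  ⊕₁-π₂ = ⟨⟩-π₂ _ _

  ⊕₁-id : id {A} ⊕₁ id {B} ≈ id
  ⊕₁-id = π-ext (≈.trans ⊕₁-π₁ (≈.trans (idʳ _) (≈.sym (idˡ _))))
                (≈.trans ⊕₁-π₂ (≈.trans (idʳ _) (≈.sym (idˡ _))))

  ⊕₁-⨾ : {f : Hom A B} {g : Hom C D} {h : Hom B E} {k : Hom D F} →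
         (f ⊕₁ g) ⨾ (h ⊕₁ k) ≈ (f ⨾ h) ⊕₁ (g ⨾ k)
  ⊕₁-⨾ {f = f} {g} {h} {k} = π-ext
    (begin
      ((f ⊕₁ g) ⨾ (h ⊕₁ k)) ⨾ π₁  ≈⟨ ⨾-assoc ⟩
      (f ⊕₁ g) ⨾ (h ⊕₁ k) ⨾ π₁    ≈⟨ ⨾-congˡ ⊕₁-π₁ ⟩
      (f ⊕₁ g) ⨾ π₁ ⨾ h           ≈⟨ ⨾-assoc ⟨
      ((f ⊕₁ g) ⨾ π₁) ⨾ h         ≈⟨ ⨾-congʳ ⊕₁-π₁ ⟩
      (π₁ ⨾ f) ⨾ h                ≈⟨ ⨾-assoc ⟩
      π₁ ⨾ f ⨾ h                  ≈⟨ ⊕₁-π₁ ⟨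
      ((f ⨾ h) ⊕₁ (g ⨾ k)) ⨾ π₁   ∎)
    (begin
      ((f ⊕₁ g) ⨾ (h ⊕₁ k)) ⨾ π₂  ≈⟨ ⨾-assoc ⟩
      (f ⊕₁ g) ⨾ (h ⊕₁ k) ⨾ π₂    ≈⟨ ⨾-congˡ ⊕₁-π₂ ⟩
      (f ⊕₁ g) ⨾ π₂ ⨾ k           ≈⟨ ⨾-assoc ⟨
      ((f ⊕₁ g) ⨾ π₂) ⨾ k         ≈⟨ ⨾-congʳ ⊕₁-π₂ ⟩
      (π₂ ⨾ g) ⨾ k                ≈⟨ ⨾-assoc ⟩
      π₂ ⨾ g ⨾ k                  ≈⟨ ⊕₁-π₂ ⟨
      ((f ⨾ h) ⊕₁ (g ⨾ k)) ⨾ π₂   ∎)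

  ι₁-⊕₁ : {f : Hom A B} {g : Hom C D} → ι₁ ⨾ (f ⊕₁ g) ≈ f ⨾ ι₁
  ι₁-⊕₁ {f = f} {g} = π-ext
    (begin
      (ι₁ ⨾ (f ⊕₁ g)) ⨾ π₁  ≈⟨ ⨾-assoc ⟩
      ι₁ ⨾ (f ⊕₁ g) ⨾ π₁    ≈⟨ ⨾-congˡ ⊕₁-π₁ ⟩
      ι₁ ⨾ π₁ ⨾ f           ≈⟨ ⨾-assoc ⟨
      (ι₁ ⨾ π₁) ⨾ f         ≈⟨ ⨾-congʳ ι₁π₁ ⟩
      id ⨾ f                ≈⟨ idˡ f ⟩
      f                     ≈⟨ idʳ f ⟨
      f ⨾ id                ≈⟨ ⨾-congˡ ι₁π₁ ⟨
      f ⨾ ι₁ ⨾ π₁           ≈⟨ ⨾-assoc ⟨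
      (f ⨾ ι₁) ⨾ π₁         ∎)
    (begin
      (ι₁ ⨾ (f ⊕₁ g)) ⨾ π₂  ≈⟨ ⨾-assoc ⟩
      ι₁ ⨾ (f ⊕₁ g) ⨾ π₂    ≈⟨ ⨾-congˡ ⊕₁-π₂ ⟩
      ι₁ ⨾ π₂ ⨾ g           ≈⟨ ⨾-assoc ⟨
      (ι₁ ⨾ π₂) ⨾ g         ≈⟨ ⨾-congʳ ι₁π₂ ⟩
      zero ⨾ g              ≈⟨ zero-⨾ ⟩
      zero                  ≈⟨ ⨾-zero ⟨
      f ⨾ zero              ≈⟨ ⨾-congˡ ι₁π₂ ⟨
      f ⨾ ι₁ ⨾ π₂           ≈⟨ ⨾-assoc ⟨
      (f ⨾ ι₁) ⨾ π₂         ∎)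

  ι₂-⊕₁ : {f : Hom A B} {g : Hom C D} → ι₂ ⨾ (f ⊕₁ g) ≈ g ⨾ ι₂
  ι₂-⊕₁ {f = f} {g} = π-ext
    (begin
      (ι₂ ⨾ (f ⊕₁ g)) ⨾ π₁  ≈⟨ ⨾-assoc ⟩
      ι₂ ⨾ (f ⊕₁ g) ⨾ π₁    ≈⟨ ⨾-congˡ ⊕₁-π₁ ⟩
      ι₂ ⨾ π₁ ⨾ f           ≈⟨ ⨾-assoc ⟨
      (ι₂ ⨾ π₁) ⨾ f         ≈⟨ ⨾-congʳ ι₂π₁ ⟩
      zero ⨾ f              ≈⟨ zero-⨾ ⟩
      zero                  ≈⟨ ⨾-zero ⟨
      g ⨾ zero              ≈⟨ ⨾-congˡ ι₂π₁ ⟨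
      g ⨾ ι₂ ⨾ π₁           ≈⟨ ⨾-assoc ⟨
      (g ⨾ ι₂) ⨾ π₁         ∎)
    (begin
      (ι₂ ⨾ (f ⊕₁ g)) ⨾ π₂  ≈⟨ ⨾-assoc ⟩
      ι₂ ⨾ (f ⊕₁ g) ⨾ π₂    ≈⟨ ⨾-congˡ ⊕₁-π₂ ⟩
      ι₂ ⨾ π₂ ⨾ g           ≈⟨ ⨾-assoc ⟨
      (ι₂ ⨾ π₂) ⨾ g         ≈⟨ ⨾-congʳ ι₂π₂ ⟩
      id ⨾ g                ≈⟨ idˡ g ⟩
      g                     ≈⟨ idʳ g ⟨
      g ⨾ id                ≈⟨ ⨾-congˡ ι₂π₂ ⟨
      g ⨾ ι₂ ⨾ π₂           ≈⟨ ⨾-assoc ⟨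
      (g ⨾ ι₂) ⨾ π₂         ∎)

  ⊕₁-† : {f : Hom A B} {g : Hom C D} → (f ⊕₁ g) † ≈ (f †) ⊕₁ (g †)
  ⊕₁-† {f = f} {g} = π-ext
    (begin
      (f ⊕₁ g) † ⨾ π₁       ≈⟨ ⨾-congˡ ι₁† ⟨
      (f ⊕₁ g) † ⨾ ι₁ †     ≈⟨ †-⨾ ι₁ (f ⊕₁ g) ⟨
      (ι₁ ⨾ (f ⊕₁ g)) †     ≈⟨ †-cong ι₁-⊕₁ ⟩
      (f ⨾ ι₁) †            ≈⟨ †-⨾ f ι₁ ⟩
      ι₁ † ⨾ f †            ≈⟨ ⨾-congʳ ι₁† ⟩
      π₁ ⨾ f †              ≈⟨ ⊕₁-π₁ ⟨
      ((f †) ⊕₁ (g †)) ⨾ π₁ ∎)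
    (begin
      (f ⊕₁ g) † ⨾ π₂       ≈⟨ ⨾-congˡ ι₂† ⟨
      (f ⊕₁ g) † ⨾ ι₂ †     ≈⟨ †-⨾ ι₂ (f ⊕₁ g) ⟨
      (ι₂ ⨾ (f ⊕₁ g)) †     ≈⟨ †-cong ι₂-⊕₁ ⟩
      (g ⨾ ι₂) †            ≈⟨ †-⨾ g ι₂ ⟩
      ι₂ † ⨾ g †            ≈⟨ ⨾-congʳ ι₂† ⟩
      π₂ ⨾ g †              ≈⟨ ⊕₁-π₂ ⟨
      ((f †) ⊕₁ (g †)) ⨾ π₂ ∎)

  block₁₁ : Hom (A ⊕ B) (C ⊕ D) → Hom A C
  block₁₁ M = ι₁ ⨾ M ⨾ π₁

  block₁₂ : Hom (A ⊕ B) (C ⊕ D) → Hom A D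
  block₁₂ M = ι₁ ⨾ M ⨾ π₂

  block₂₁ : Hom (A ⊕ B) (C ⊕ D) → Hom B C
  block₂₁ M = ι₂ ⨾ M ⨾ π₁

  block₂₂ : Hom (A ⊕ B) (C ⊕ D) → Hom B D
  block₂₂ M = ι₂ ⨾ M ⨾ π₂

  block-ext : {M N : Hom (A ⊕ B) (C ⊕ D)} →
              block₁₁ M ≈ block₁₁ N → block₁₂ M ≈ block₁₂ N →
              block₂₁ M ≈ block₂₁ N → block₂₂ M ≈ block₂₂ N → M ≈ N
  block-ext p₁₁ p₁₂ p₂₁ p₂₂ = ι-ext (π-ext (entry p₁₁) (entry p₁₂)) (π-ext (entry p₂₁) (entry p₂₂))
    where
    entry : {i : Hom P Q} {M N : Hom Q R} {p : Hom R S} →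
            i ⨾ M ⨾ p ≈ i ⨾ N ⨾ p → (i ⨾ M) ⨾ p ≈ (i ⨾ N) ⨾ p
    entry q = ≈.trans ⨾-assoc (≈.trans q (≈.sym ⨾-assoc))

  block₁₁-⊕₁ : {f : Hom A C} {g : Hom B D} → block₁₁ (f ⊕₁ g) ≈ f
  block₁₁-⊕₁ {f = f} = begin
    ι₁ ⨾ (f ⊕₁ _) ⨾ π₁  ≈⟨ ⨾-congˡ ⊕₁-π₁ ⟩
    ι₁ ⨾ π₁ ⨾ f         ≈⟨ ⨾-assoc ⟨
    (ι₁ ⨾ π₁) ⨾ f       ≈⟨ ⨾-congʳ ι₁π₁ ⟩
    id ⨾ f              ≈⟨ idˡ f ⟩
    f                   ∎

  block₁₂-⊕₁ : {f : Hom A C} {g : Hom B D} → block₁₂ (f ⊕₁ g) ≈ zero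
  block₁₂-⊕₁ {g = g} = begin
    ι₁ ⨾ (_ ⊕₁ g) ⨾ π₂  ≈⟨ ⨾-congˡ ⊕₁-π₂ ⟩
    ι₁ ⨾ π₂ ⨾ g         ≈⟨ ⨾-assoc ⟨
    (ι₁ ⨾ π₂) ⨾ g       ≈⟨ ⨾-congʳ ι₁π₂ ⟩
    zero ⨾ g            ≈⟨ zero-⨾ ⟩
    zero                ∎

  block₂₁-⊕₁ : {f : Hom A C} {g : Hom B D} → block₂₁ (f ⊕₁ g) ≈ zero
  block₂₁-⊕₁ {f = f} = begin
    ι₂ ⨾ (f ⊕₁ _) ⨾ π₁  ≈⟨ ⨾-congˡ ⊕₁-π₁ ⟩
    ι₂ ⨾ π₁ ⨾ f         ≈⟨ ⨾-assoc ⟨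
    (ι₂ ⨾ π₁) ⨾ f       ≈⟨ ⨾-congʳ ι₂π₁ ⟩
    zero ⨾ f            ≈⟨ zero-⨾ ⟩
    zero                ∎

  block₂₂-⊕₁ : {f : Hom A C} {g : Hom B D} → block₂₂ (f ⊕₁ g) ≈ g
  block₂₂-⊕₁ {g = g} = begin
    ι₂ ⨾ (_ ⊕₁ g) ⨾ π₂  ≈⟨ ⨾-congˡ ⊕₁-π₂ ⟩
    ι₂ ⨾ π₂ ⨾ g         ≈⟨ ⨾-assoc ⟨
    (ι₂ ⨾ π₂) ⨾ g       ≈⟨ ⨾-congʳ ι₂π₂ ⟩
    id ⨾ g              ≈⟨ idˡ g ⟩
    g                   ∎

  ⊕₁-injective : {f f′ : Hom A C} {g g′ : Hom B D} → f ⊕₁ g ≈ f′ ⊕₁ g′ → f ≈ f′ × g ≈ g′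
  ⊕₁-injective p =
    ≈.trans (≈.sym block₁₁-⊕₁) (≈.trans (⨾-congˡ (⨾-congʳ p)) block₁₁-⊕₁) ,
    ≈.trans (≈.sym block₂₂-⊕₁) (≈.trans (⨾-congˡ (⨾-congʳ p)) block₂₂-⊕₁)

  diagonal : {M : Hom (A ⊕ B) (C ⊕ D)} →
             block₁₂ M ≈ zero → block₂₁ M ≈ zero → M ≈ block₁₁ M ⊕₁ block₂₂ M
  diagonal p₁₂ p₂₁ = block-ext (≈.sym block₁₁-⊕₁) (≈.trans p₁₂ (≈.sym block₁₂-⊕₁))
                               (≈.trans p₂₁ (≈.sym block₂₁-⊕₁)) (≈.sym block₂₂-⊕₁)

  block₂₁-† : {M : Hom (A ⊕ B) (C ⊕ D)} → block₂₁ (M †) ≈ block₁₂ M †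
  block₂₁-† {M = M} = begin
    ι₂ ⨾ M † ⨾ π₁         ≈⟨ ⨾-cong (≈.sym π₂†) (⨾-congˡ (≈.sym ι₁†)) ⟩
    π₂ † ⨾ M † ⨾ ι₁ †     ≈⟨ †-⨾³ ι₁ M π₂ ⟨
    (ι₁ ⨾ M ⨾ π₂) †       ∎

  block₁₂-† : {M : Hom (A ⊕ B) (C ⊕ D)} → block₁₂ (M †) ≈ block₂₁ M †
  block₁₂-† {M = M} = begin
    ι₁ ⨾ M † ⨾ π₂         ≈⟨ ⨾-cong (≈.sym π₁†) (⨾-congˡ (≈.sym ι₂†)) ⟩
    π₁ † ⨾ M † ⨾ ι₂ †     ≈⟨ †-⨾³ ι₂ M π₁ ⟨
    (ι₂ ⨾ M ⨾ π₁) †       ∎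

  Unitary-⊕₁⁻ : {f : Hom A C} {g : Hom B D} → Unitary (f ⊕₁ g) → Unitary f × Unitary g
  Unitary-⊕₁⁻ {f = f} {g} u =
    record { unitˡ = proj₁ unitˡ-blocks ; unitʳ = proj₁ unitʳ-blocks } ,
    record { unitˡ = proj₂ unitˡ-blocks ; unitʳ = proj₂ unitʳ-blocks }
    where
    unitˡ-blocks : f ⨾ f † ≈ id × g ⨾ g † ≈ id
    unitˡ-blocks = ⊕₁-injective (begin
      (f ⨾ f †) ⊕₁ (g ⨾ g †)     ≈⟨ ⊕₁-⨾ ⟨
      (f ⊕₁ g) ⨾ ((f †) ⊕₁ (g †)) ≈⟨ ⨾-congˡ ⊕₁-† ⟨
      (f ⊕₁ g) ⨾ (f ⊕₁ g) †      ≈⟨ Unitary.unitˡ u ⟩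
      id                         ≈⟨ ⊕₁-id ⟨
      id ⊕₁ id                   ∎)
    unitʳ-blocks : f † ⨾ f ≈ id × g † ⨾ g ≈ id
    unitʳ-blocks = ⊕₁-injective (begin
      (f † ⨾ f) ⊕₁ (g † ⨾ g)     ≈⟨ ⊕₁-⨾ ⟨
      ((f †) ⊕₁ (g †)) ⨾ (f ⊕₁ g) ≈⟨ ⨾-congʳ ⊕₁-† ⟨
      (f ⊕₁ g) † ⨾ (f ⊕₁ g)      ≈⟨ Unitary.unitʳ u ⟩
      id                         ≈⟨ ⊕₁-id ⟨
      id ⊕₁ id                   ∎)

  ι₁-⊕₁-⨾ : {f : Hom A B} {g : Hom C D} {h : Hom (B ⊕ D) E} → ι₁ ⨾ (f ⊕₁ g) ⨾ h ≈ f ⨾ ι₁ ⨾ h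
  ι₁-⊕₁-⨾ = ≈.trans (≈.sym ⨾-assoc) (≈.trans (⨾-congʳ ι₁-⊕₁) ⨾-assoc)

  ι₂-⊕₁zero-⨾ : {f : Hom A B} {h : Hom (B ⊕ D) E} → ι₂ ⨾ (f ⊕₁ zero {C} {D}) ⨾ h ≈ zero
  ι₂-⊕₁zero-⨾ = ≈.trans (≈.sym ⨾-assoc) (≈.trans (⨾-congʳ (≈.trans ι₂-⊕₁ zero-⨾)) zero-⨾)

  ⨾-⊕₁-π₁ : {h : Hom E (A ⊕ C)} {f : Hom A B} {g : Hom C D} → h ⨾ (f ⊕₁ g) ⨾ π₁ ≈ (h ⨾ π₁) ⨾ f
  ⨾-⊕₁-π₁ = ≈.trans (⨾-congˡ ⊕₁-π₁) (≈.sym ⨾-assoc)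

  ⨾-⊕₁zero-π₂ : {h : Hom E (A ⊕ C)} {f : Hom A B} → h ⨾ (f ⊕₁ zero {C} {D}) ⨾ π₂ ≈ zero
  ⨾-⊕₁zero-π₂ = ≈.trans (⨾-congˡ (≈.trans ⊕₁-π₂ ⨾-zero)) ⨾-zero

  module _ {P₁ Q₁ R₁ S₁ P₂ Q₂ R₂ S₂ : Obj}
           {a : Hom P₁ R₁} {b : Hom P₂ R₂}
           {U : Hom (P₁ ⊕ Q₁) (P₂ ⊕ Q₂)} {V : Hom (R₁ ⊕ S₁) (R₂ ⊕ S₂)}
           (square : (a ⊕₁ zero {Q₁} {S₁}) ⨾ V ≈ U ⨾ (b ⊕₁ zero {Q₂} {S₂})) where

    private
      square-entry : (i : Hom T (P₁ ⊕ Q₁)) (p : Hom (R₂ ⊕ S₂) E) →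
                     i ⨾ (a ⊕₁ zero) ⨾ V ⨾ p ≈ i ⨾ U ⨾ (b ⊕₁ zero) ⨾ p
      square-entry i p = ⨾-congˡ (≈.trans (≈.sym ⨾-assoc) (≈.trans (⨾-congʳ square) ⨾-assoc))

    square-block₁₁ : a ⨾ block₁₁ V ≈ block₁₁ U ⨾ b
    square-block₁₁ = begin
      a ⨾ ι₁ ⨾ V ⨾ π₁                     ≈⟨ ι₁-⊕₁-⨾ ⟨
      ι₁ ⨾ (a ⊕₁ zero) ⨾ V ⨾ π₁           ≈⟨ square-entry ι₁ π₁ ⟩
      ι₁ ⨾ U ⨾ (b ⊕₁ zero) ⨾ π₁           ≈⟨ ⨾-congˡ ⨾-⊕₁-π₁ ⟩
      ι₁ ⨾ (U ⨾ π₁) ⨾ b                   ≈⟨ ⨾-assoc ⟨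
      (ι₁ ⨾ U ⨾ π₁) ⨾ b                   ∎

    square-block₁₂ : IsIso a → block₁₂ V ≈ zero
    square-block₁₂ a-iso = IsIso-cancelˡ a-iso (begin
      a ⨾ ι₁ ⨾ V ⨾ π₂                     ≈⟨ ι₁-⊕₁-⨾ ⟨
      ι₁ ⨾ (a ⊕₁ zero) ⨾ V ⨾ π₂           ≈⟨ square-entry ι₁ π₂ ⟩
      ι₁ ⨾ U ⨾ (b ⊕₁ zero) ⨾ π₂           ≈⟨ ⨾-congˡ ⨾-⊕₁zero-π₂ ⟩
      ι₁ ⨾ zero                           ≈⟨ ⨾-zero ⟩
      zero                                ≈⟨ ⨾-zero ⟨
      a ⨾ zero                            ∎)

    square-block₂₁ : IsIso b → block₂₁ U ≈ zero
    square-block₂₁ b-iso = IsIso-cancelʳ b-iso (begin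
      (ι₂ ⨾ U ⨾ π₁) ⨾ b                   ≈⟨ ⨾-assoc ⟩
      ι₂ ⨾ (U ⨾ π₁) ⨾ b                   ≈⟨ ⨾-congˡ ⨾-⊕₁-π₁ ⟨
      ι₂ ⨾ U ⨾ (b ⊕₁ zero) ⨾ π₁           ≈⟨ square-entry ι₂ π₁ ⟨
      ι₂ ⨾ (a ⊕₁ zero) ⨾ V ⨾ π₁           ≈⟨ ι₂-⊕₁zero-⨾ ⟩
      zero                                ≈⟨ zero-⨾ ⟨
      zero ⨾ b                            ∎)

  module UnitarySquare {P₁ Q₁ R₁ S₁ P₂ Q₂ R₂ S₂ : Obj}
           {a : Hom P₁ R₁} {b : Hom P₂ R₂}
           {U : Hom (P₁ ⊕ Q₁) (P₂ ⊕ Q₂)} {V : Hom (R₁ ⊕ S₁) (R₂ ⊕ S₂)}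
           (a-iso : IsIso a) (b-iso : IsIso b) (U-unitary : Unitary U) (V-unitary : Unitary V)
           (square : (a ⊕₁ zero {Q₁} {S₁}) ⨾ V ≈ U ⨾ (b ⊕₁ zero {Q₂} {S₂})) where

    private
      transposed : (b ⊕₁ zero {Q₂} {S₂}) ⨾ V † ≈ U † ⨾ (a ⊕₁ zero {Q₁} {S₁})
      transposed = square-transpose U-unitary V-unitary square

    U-diagonal : U ≈ block₁₁ U ⊕₁ block₂₂ U
    U-diagonal = diagonal
      (†-reflects-zero (≈.trans (≈.sym block₂₁-†) (square-block₂₁ transposed a-iso)))
      (square-block₂₁ square b-iso)

    V-diagonal : V ≈ block₁₁ V ⊕₁ block₂₂ V
    V-diagonal = diagonal
      (square-block₁₂ square a-iso)
      (†-reflects-zero (≈.trans (≈.sym block₁₂-†) (square-block₁₂ transposed b-iso)))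

    U-blocks-unitary : Unitary (block₁₁ U) × Unitary (block₂₂ U)
    U-blocks-unitary = Unitary-⊕₁⁻ (Unitary-resp U-diagonal U-unitary)

    V-blocks-unitary : Unitary (block₁₁ V) × Unitary (block₂₂ V)
    V-blocks-unitary = Unitary-⊕₁⁻ (Unitary-resp V-diagonal V-unitary)

  IsGSVD-square : {f : Hom A B} {X₁ Y₁ Z₁ W₁ X₂ Y₂ Z₂ W₂ : Obj}
                  {u₁ : Hom A (X₁ ⊕ Z₁)} {d₁ : Hom X₁ Y₁} {v₁ : Hom (Y₁ ⊕ W₁) B}
                  {u₂ : Hom A (X₂ ⊕ Z₂)} {d₂ : Hom X₂ Y₂} {v₂ : Hom (Y₂ ⊕ W₂) B} →
                  IsGSVD f u₁ d₁ v₁ → IsGSVD f u₂ d₂ v₂ →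
                  (d₁ ⊕₁ zero {Z₁} {W₁}) ⨾ v₁ ⨾ v₂ † ≈ (u₁ † ⨾ u₂) ⨾ (d₂ ⊕₁ zero {Z₂} {W₂})
  IsGSVD-square {u₁ = u₁} {d₁} {v₁} {u₂} {d₂} {v₂} G₁ G₂ =
    ≈.trans (≈.sym ⨾-assoc) (unitary-transposeʳ (IsGSVD.v-unitary G₂) (begin
      D₁ ⨾ v₁                    ≈⟨ unitary-transposeˡ (IsGSVD.u-unitary G₁)
                                      (≈.trans (≈.sym (IsGSVD.factor G₁)) (IsGSVD.factor G₂)) ⟩
      u₁ † ⨾ u₂ ⨾ D₂ ⨾ v₂        ≈⟨ ⨾-congˡ ⨾-assoc ⟨
      u₁ † ⨾ (u₂ ⨾ D₂) ⨾ v₂      ≈⟨ ⨾-assoc ⟨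
      (u₁ † ⨾ u₂ ⨾ D₂) ⨾ v₂      ≈⟨ ⨾-congʳ ⨾-assoc ⟨
      ((u₁ † ⨾ u₂) ⨾ D₂) ⨾ v₂    ∎))
    where
    D₁ = d₁ ⊕₁ zero
    D₂ = d₂ ⊕₁ zero

mainTheorem14 : ∀ {o ℓ e : Level} (𝒞 : DaggerBiproductCategory o ℓ e) →
    let open DaggerBiproductCategory 𝒞 in
    ∀ {A B X₁ Y₁ Z₁ W₁ X₂ Y₂ Z₂ W₂ : Obj} (f : Hom A B)
      (u₁ : Hom A (X₁ ⊕ Z₁)) (d₁ : Hom X₁ Y₁) (v₁ : Hom (Y₁ ⊕ W₁) B)
      (u₂ : Hom A (X₂ ⊕ Z₂)) (d₂ : Hom X₂ Y₂) (v₂ : Hom (Y₂ ⊕ W₂) B) →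
    IsGSVD f u₁ d₁ v₁ → IsGSVD f u₂ d₂ v₂ →
    Σ[ x ∈ Hom X₁ X₂ ] Σ[ y ∈ Hom Y₁ Y₂ ] Σ[ z ∈ Hom Z₁ Z₂ ] Σ[ w ∈ Hom W₁ W₂ ]
      ((Unitary x × Unitary y × Unitary z × Unitary w
        × u₁ ⨾ (x ⊕₁ z) ≈ u₂ × d₁ ⨾ y ≈ x ⨾ d₂ × v₁ ≈ (y ⊕₁ w) ⨾ v₂)
      × (∀ (x′ : Hom X₁ X₂) (y′ : Hom Y₁ Y₂) (z′ : Hom Z₁ Z₂) (w′ : Hom W₁ W₂) →
           Unitary x′ → Unitary y′ → Unitary z′ → Unitary w′ →
           u₁ ⨾ (x′ ⊕₁ z′) ≈ u₂ → d₁ ⨾ y′ ≈ x′ ⨾ d₂ → v₁ ≈ (y′ ⊕₁ w′) ⨾ v₂ →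
           (x′ ≈ x × y′ ≈ y × z′ ≈ z × w′ ≈ w)))
mainTheorem14 𝒞 f u₁ d₁ v₁ u₂ d₂ v₂ G₁ G₂ =
  block₁₁ (u₁ † ⨾ u₂) , block₁₁ (v₁ ⨾ v₂ †) , block₂₂ (u₁ † ⨾ u₂) , block₂₂ (v₁ ⨾ v₂ †) ,
  (proj₁ U-blocks-unitary , proj₁ V-blocks-unitary , proj₂ U-blocks-unitary , proj₂ V-blocks-unitary ,
   ≈.trans (⨾-congˡ (≈.sym U-diagonal)) (inverse-cancelˡ (Unitary.unitˡ u₁-unitary)) ,
   square-block₁₁ square ,
   ≈.trans (≈.sym (inverse-cancelʳ (Unitary.unitʳ v₂-unitary))) (⨾-congʳ V-diagonal)) ,
  λ { x′ y′ z′ w′ _ _ _ _ u-eq _ v-eq →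
      let (x′≈x , z′≈z) = ⊕₁-injective (≈.trans (unitary-transposeˡ u₁-unitary u-eq) U-diagonal)
          (y′≈y , w′≈w) = ⊕₁-injective (≈.trans (≈.sym (unitary-transposeʳ v₂-unitary v-eq)) V-diagonal)
      in x′≈x , y′≈y , z′≈z , w′≈w }
  where
  open DaggerBiproductCategory 𝒞
  open Properties 𝒞
  open IsGSVD G₁ using () renaming (u-unitary to u₁-unitary; v-unitary to v₁-unitary; d-iso to d₁-iso)
  open IsGSVD G₂ using () renaming (u-unitary to u₂-unitary; v-unitary to v₂-unitary; d-iso to d₂-iso)
  U-unitary : Unitary (u₁ † ⨾ u₂)
  U-unitary = Unitary-⨾ (Unitary-† u₁-unitary) u₂-unitary
  V-unitary : Unitary (v₁ ⨾ v₂ †)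
  V-unitary = Unitary-⨾ v₁-unitary (Unitary-† v₂-unitary)
  square : (d₁ ⊕₁ zero) ⨾ v₁ ⨾ v₂ † ≈ (u₁ † ⨾ u₂) ⨾ (d₂ ⊕₁ zero)
  square = IsGSVD-square G₁ G₂
  open UnitarySquare d₁-iso d₂-iso U-unitary V-unitary square
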